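{- Let $R$ be an $n(R)$-place relation on a finite set $\mathcal U$. Then $\lambda_1(R)\le\lambda'_0(R)+1$, and if equality holds then $\lambda_1(R)\le2^{2^{n(R)^2}}$.
   Context: For $A\subseteq\mathcal U$ and $b\in\mathcal U$, $\mathrm{tp}_{\mathrm{bs}}(b,A,R)$ is the set of formulas $\varphi(x,\bar a)$, where $\varphi(x,\bar y)$ is an atomic or negated atomic formula in the language $\{=,R\}$ and $\bar a$ is a tuple from $A$, such that $(\mathcal U,R)\models\varphi(b,\bar a)$. $\lambda_1(R)=\max\{|\{\mathrm{tp}_{\mathrm{bs}}(a,A,R):a\in\mathcal U\setminus A\}|:A\subseteq\mathcal U\}$. For $A\subseteq\mathcal U$, $\bar b\approx_A\bar c$ means: $b_i\in A\iff c_i\in A$; $b_i\in A\Rightarrow b_i=c_i$; $b_i=b_j\iff c_i=c_j$. $\lambda'_0(R)=\min\{|A|:A\subseteq\mathcal U$ and $\bar b\approx_A\bar c\Rightarrow(R(\bar b)\iff R(\bar c))$ for all $\bar b,\bar c\in\mathcal U^{n(R)}\}$. -}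

module Defs where

open import Data.Nat using (ℕ; _≤_)
open import Data.Bool using (Bool; true)
open import Data.Fin using (Fin)
open import Data.Fin.Subset using (Subset; _∈_; _∉_; ∣_∣)
open import Data.Unit using (⊤)
open import Data.Product using (_×_; Σ; ∃)
open import Relation.Nullary using (¬_)
open import Relation.Binary.PropositionalEquality using (_≡_)

-- The universe 𝒰 is Fin N; an n-place relation R on 𝒰 is given by its
-- characteristic function on n-tuples (tuples are functions Fin n → Fin N).
Tuple : ℕ → ℕ → Set
Tuple N n = Fin n → Fin N

Rel : ℕ → ℕ → Set
Rel N n = Tuple N n → Bool

infix 2 _⇔_
_⇔_ : Set → Set → Set
P ⇔ Q = (P → Q) × (Q → P)

-- Syntax of atomic / negated atomic formulas φ(x, ā) in the language
-- {=, R}, with the single free variable x and parameters from 𝒰.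

data Term (N : ℕ) : Set where
  var : Term N
  par : Fin N → Term N

data Atom (N n : ℕ) : Set where
  eqA  : Term N → Term N → Atom N n
  relA : (Fin n → Term N) → Atom N n

data Literal (N n : ℕ) : Set where
  pos : Atom N n → Literal N n
  neg : Atom N n → Literal N n

TermOver : ∀ {N} → Subset N → Term N → Set
TermOver A var     = ⊤
TermOver A (par a) = a ∈ A

AtomOver : ∀ {N n} → Subset N → Atom N n → Set
AtomOver A (eqA s t) = TermOver A s × TermOver A t
AtomOver {n = n} A (relA ts) = (i : Fin n) → TermOver A (ts i)

LitOver : ∀ {N n} → Subset N → Literal N n → Set
LitOver A (pos φ) = AtomOver A φ
LitOver A (neg φ) = AtomOver A φ

evalT : ∀ {N} → Fin N → Term N → Fin N
evalT b var     = b
evalT b (par a) = a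

SatAtom : ∀ {N n} → Rel N n → Fin N → Atom N n → Set
SatAtom R b (eqA s t) = evalT b s ≡ evalT b t
SatAtom R b (relA ts) = R (λ i → evalT b (ts i)) ≡ true

Sat : ∀ {N n} → Rel N n → Fin N → Literal N n → Set
Sat R b (pos φ) = SatAtom R b φ
Sat R b (neg φ) = ¬ SatAtom R b φ

InTp : ∀ {N n} → Rel N n → Fin N → Subset N → Literal N n → Set
InTp R b A φ = LitOver A φ × Sat R b φ

SameTp : ∀ {N n} → Rel N n → Subset N → Fin N → Fin N → Set
SameTp R A b c = ∀ φ → InTp R b A φ ⇔ InTp R c A φ

-- |{tp_bs(a,A,R) : a ∈ 𝒰 ∖ A}| = t : there are representatives
-- r₀,…,r_{t-1} ∉ A of pairwise distinct types such that every a ∉ A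
-- has the type of some rᵢ.
NumTypes : ∀ {N n} → Rel N n → Subset N → ℕ → Set
NumTypes {N} R A t =
  Σ (Fin t → Fin N) λ r →
    ((i : Fin t) → r i ∉ A) ×
    ((i j : Fin t) → SameTp R A (r i) (r j) → i ≡ j) ×
    ((a : Fin N) → a ∉ A → ∃ λ (i : Fin t) → SameTp R A a (r i))

IsLambda1 : ∀ {N n} → Rel N n → ℕ → Set
IsLambda1 {N} R m =
  (∃ λ (A : Subset N) → NumTypes R A m) ×
  ((A : Subset N) (t : ℕ) → NumTypes R A t → t ≤ m)

Approx : ∀ {N n} → Subset N → Tuple N n → Tuple N n → Set
Approx {N} {n} A b c =
  ((i : Fin n) → (b i ∈ A ⇔ c i ∈ A)) ×
  ((i : Fin n) → b i ∈ A → b i ≡ c i) ×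
  ((i j : Fin n) → (b i ≡ b j ⇔ c i ≡ c j))

Determines : ∀ {N n} → Rel N n → Subset N → Set
Determines {N} {n} R A =
  (b c : Tuple N n) → Approx A b c → (R b ≡ true ⇔ R c ≡ true)

IsLambda0' : ∀ {N n} → Rel N n → ℕ → Set
IsLambda0' {N} R k =
  (∃ λ (A : Subset N) → Determines R A × ∣ A ∣ ≡ k) ×
  ((A : Subset N) → Determines R A → k ≤ ∣ A ∣)

-- Let A attain λ₁ and let A₀ be a determining set with |A₀| = λ'₀ = k. For x, y ∉ A ∪ A₀ and any tuple
-- of terms over A, the instances at x and at y are ≈_A₀, so x and y have the same type over A. The types
-- over A are therefore this one plus at most one per point of A₀ ─ A, whence λ₁ ≤ k + 1.
-- Equality forces A ∩ A₀ = ∅. Then the only coordinates in A₀ of an instance at x ∉ A are copies of x, so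
-- whether R holds on it depends only on the pattern of the tuple of terms (which positions hold x, which
-- hold equal parameters), and the type of x is a function from the 2^(n²) patterns to Bool.
module Submission where

open import Defs
open import Data.Nat using (ℕ; zero; suc; _≤_; _*_; _^_; z≤n; s≤s)
open import Data.Nat.Properties using (≤-trans; <-irrefl; module ≤-Reasoning)
open import Data.Bool using (Bool; true; false; T)
import Data.Bool.Properties as Bool
open import Data.Fin using (Fin; zero; suc; _≟_; remQuot; combine; funToFin; finToFun)
open import Data.Fin.Properties
  using (any?; all?; 2↔Bool; 0≢1+n; suc-injective; remQuot-combine; finToFun-funToFin; injective⇒≤)
open import Data.Fin.Subset using (Subset; _∈_; _∉_; ∣_∣; _─_; _-_; _∩_; inside; Empty)
open import Data.Fin.Subset.Properties
  using ( _∈?_; x∈p∧x≢y⇒x∈p-y; x∈p⇒∣p-x∣<∣p∣; x∈p∧x∉q⇒x∈p─q; x∈p∩q⁺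
        ; ∣p─q∣≤∣p∣; p∩q≢∅⇒∣p─q∣<∣p∣)
open import Data.Vec using (_∷_; here; there)
open import Data.Product using (_×_; ∃; _,_; proj₁; proj₂; swap; uncurry)
open import Data.Empty using (⊥-elim)
open import Data.Unit using (tt)
open import Function using (_∘_; id)
open import Function.Bundles using (Inverse; Injection)
open import Function.Definitions using (Injective)
open import Function.Properties.Inverse using (↔-sym; ↔⇒↣)
open import Relation.Nullary using (Dec; yes; no; does; contradiction)
open import Relation.Nullary.Decidable using (_×-dec_; dec-true; isYes; toWitness; fromWitness)
open import Relation.Unary using (Decidable)
open import Relation.Binary.PropositionalEquality

injective⇒≤∣p∣ : ∀ {t M} (p : Subset M) {f : Fin t → Fin M} →
                Injective _≡_ _≡_ f → (∀ i → f i ∈ p) → t ≤ ∣ p ∣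
injective⇒≤∣p∣ {zero}  p         inj f∈p = z≤n
injective⇒≤∣p∣ {suc t} p {f = f} inj f∈p =
  ≤-trans (s≤s (injective⇒≤∣p∣ (p - f zero) (suc-injective ∘ inj) f∘suc∈p-f0))
          (x∈p⇒∣p-x∣<∣p∣ (f∈p zero))
  where
  f∘suc∈p-f0 : ∀ i → f (suc i) ∈ p - f zero
  f∘suc∈p-f0 i = x∈p∧x≢y⇒x∈p-y (f∈p (suc i)) (λ e → 0≢1+n (sym (inj e)))

bit : Bool → Fin 2
bit = Inverse.from 2↔Bool

bit-injective : Injective _≡_ _≡_ bit
bit-injective = Injection.injective (↔⇒↣ (↔-sym 2↔Bool))

TupleOver : ∀ {N n} → Subset N → (Fin n → Term N) → Set
TupleOver A ts = ∀ i → TermOver A (ts i)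

instantiate : ∀ {N n} → Fin N → (Fin n → Term N) → Tuple N n
instantiate x ts i = evalT x (ts i)

-- On the diagonal, sameParam s s tells whether s is x; off it, whether two parameters coincide.
sameParam : ∀ {N} → Term N → Term N → Bool
sameParam (par a) (par b) = does (a ≟ b)
sameParam _       _       = false

module _ {N : ℕ} where

  sameParam-refl : (a : Fin N) → sameParam (par a) (par a) ≡ true
  sameParam-refl a = dec-true (a ≟ a) refl

  sameParam⇒≡ : (s u : Term N) → sameParam s u ≡ true → s ≡ u
  sameParam⇒≡ var     var     ()
  sameParam⇒≡ var     (par _) ()
  sameParam⇒≡ (par _) var     ()
  sameParam⇒≡ (par a) (par b) e with a ≟ b | e
  ... | yes refl | _ = refl
  ... | no _     | ()

  var-transfer : {s : Term N} (s' : Term N) →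
                 sameParam s s ≡ sameParam s' s' → s ≡ var → s' ≡ var
  var-transfer var     _ _    = refl
  var-transfer (par a) e refl = contradiction (trans e (sameParam-refl a)) λ ()

  ≡-transfer : {s u : Term N} (s' u' : Term N) →
    sameParam s s ≡ sameParam s' s' → sameParam u u ≡ sameParam u' u' →
    sameParam s u ≡ sameParam s' u' → s ≡ u → s' ≡ u'
  ≡-transfer {var}   s' u' es eu _ refl =
    trans (var-transfer s' es refl) (sym (var-transfer u' eu refl))
  ≡-transfer {par a} s' u' _  _  e refl = sameParam⇒≡ s' u' (trans (sym e) (sameParam-refl a))

SamePattern : ∀ {N n} → (Fin n → Term N) → (Fin n → Term N) → Set
SamePattern ts ts' = ∀ i j → sameParam (ts i) (ts j) ≡ sameParam (ts' i) (ts' j)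

≗⇒samePattern : ∀ {N n} {ts ts' : Fin n → Term N} → ts ≗ ts' → SamePattern ts ts'
≗⇒samePattern ts≗ts' i j = cong₂ sameParam (ts≗ts' i) (ts≗ts' j)

samePattern-sym : ∀ {N n} (ts ts' : Fin n → Term N) → SamePattern ts ts' → SamePattern ts' ts
samePattern-sym _ _ same i j = sym (same i j)

patternBits : ∀ {N n} → (Fin n → Term N) → Fin (n * n) → Fin 2
patternBits {n = n} ts = bit ∘ uncurry (λ i j → sameParam (ts i) (ts j)) ∘ remQuot n

patternBits⇒samePattern : ∀ {N n} (ts ts' : Fin n → Term N) →
                          patternBits ts ≗ patternBits ts' → SamePattern ts ts'
patternBits⇒samePattern ts ts' same i j = bit-injective (begin
  bit (sameParam (ts i) (ts j))   ≡⟨ patternBits-combine ts ⟨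
  patternBits ts (combine i j)    ≡⟨ same (combine i j) ⟩
  patternBits ts' (combine i j)   ≡⟨ patternBits-combine ts' ⟩
  bit (sameParam (ts' i) (ts' j)) ∎)
  where
  open ≡-Reasoning
  patternBits-combine : ∀ us → patternBits us (combine i j) ≡ bit (sameParam (us i) (us j))
  patternBits-combine us =
    cong (bit ∘ uncurry (λ i j → sameParam (us i) (us j))) (remQuot-combine i j)

termOf : ∀ {N} → Fin (suc N) → Term N
termOf zero    = var
termOf (suc a) = par a

indexOf : ∀ {N} → Term N → Fin (suc N)
indexOf var     = zero
indexOf (par a) = suc a

termOf-indexOf : ∀ {N} (s : Term N) → termOf (indexOf s) ≡ s
termOf-indexOf var     = refl
termOf-indexOf (par a) = refl

-- An enumeration of all n-tuples of terms, making ∃ over them decidable.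
tupleOf : ∀ {N} n → Fin (suc N ^ n) → Fin n → Term N
tupleOf n w = termOf ∘ finToFun w

tupleOf-funToFin : ∀ {N n} (ts : Fin n → Term N) → tupleOf n (funToFin (indexOf ∘ ts)) ≗ ts
tupleOf-funToFin ts i =
  trans (cong termOf (finToFun-funToFin (indexOf ∘ ts) i)) (termOf-indexOf (ts i))

tupleOver? : ∀ {N n} (A : Subset N) → Decidable (TupleOver {n = n} A)
tupleOver? A ts = all? (termOver? ∘ ts)
  where
  termOver? : Decidable (TermOver A)
  termOver? var     = yes tt
  termOver? (par a) = a ∈? A

module _ {N : ℕ} {A : Subset N} {x : Fin N} (x∉A : x ∉ A) where

  evalT-injective : (s u : Term N) → TermOver A s → TermOver A u →
                    evalT x s ≡ evalT x u → s ≡ u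
  evalT-injective var     var     _   _   _ = refl
  evalT-injective var     (par a) _   a∈A e = ⊥-elim (x∉A (subst (_∈ A) (sym e) a∈A))
  evalT-injective (par a) var     a∈A _   e = ⊥-elim (x∉A (subst (_∈ A) e a∈A))
  evalT-injective (par a) (par b) _   _   e = cong par e

  evalT-≡-transfer : ∀ {y} (s u : Term N) → TermOver A s → TermOver A u →
                     evalT x s ≡ evalT x u → evalT y s ≡ evalT y u
  evalT-≡-transfer {y} s u s∈A u∈A = cong (evalT y) ∘ evalT-injective s u s∈A u∈A

module _ {N n : ℕ} (R : Rel N n) (A : Subset N) where

  ≡⇒sameTp : ∀ {x y} → x ≡ y → SameTp R A x y
  ≡⇒sameTp refl φ = id , id

  sameTp-fromAtoms : ∀ {x y} →
    (∀ φ → AtomOver A φ → SatAtom R x φ ⇔ SatAtom R y φ) → SameTp R A x y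
  sameTp-fromAtoms atoms ψ = transfer atoms ψ , transfer (λ φ φ⊆A → swap (atoms φ φ⊆A)) ψ
    where
    transfer : ∀ {x y} → (∀ φ → AtomOver A φ → SatAtom R x φ ⇔ SatAtom R y φ) →
               ∀ ψ → InTp R x A ψ → InTp R y A ψ
    transfer atoms (pos φ) (φ⊆A , sat)   = φ⊆A , proj₁ (atoms φ φ⊆A) sat
    transfer atoms (neg φ) (φ⊆A , unsat) = φ⊆A , unsat ∘ proj₂ (atoms φ φ⊆A)

  -- Equality atoms over A cannot tell apart two points outside A.
  sameTp-fromRel : ∀ {x y} → x ∉ A → y ∉ A →
    (∀ ts → TupleOver A ts → R (instantiate x ts) ≡ true ⇔ R (instantiate y ts) ≡ true) →
    SameTp R A x y
  sameTp-fromRel x∉A y∉A rel = sameTp-fromAtoms λ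
    { (eqA s u) (s∈A , u∈A) →
        evalT-≡-transfer x∉A s u s∈A u∈A , evalT-≡-transfer y∉A s u s∈A u∈A
    ; (relA ts) ts⊆A → rel ts ts⊆A
    }

  module _ (A₀ : Subset N) (det : Determines R A₀) where

    sameTp-outside : ∀ {x y} → x ∉ A → y ∉ A → x ∉ A₀ → y ∉ A₀ → SameTp R A x y
    sameTp-outside {x} {y} x∉A y∉A x∉A₀ y∉A₀ = sameTp-fromRel x∉A y∉A λ ts ts⊆A →
      det _ _ ( (λ i → ∈A₀⇔ (ts i))
              , (λ i → ∈A₀⇒≡ (ts i))
              , (λ i j → evalT-≡-transfer x∉A (ts i) (ts j) (ts⊆A i) (ts⊆A j)
                       , evalT-≡-transfer y∉A (ts i) (ts j) (ts⊆A i) (ts⊆A j)))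
      where
      ∈A₀⇔ : (s : Term N) → evalT x s ∈ A₀ ⇔ evalT y s ∈ A₀
      ∈A₀⇔ var     = ⊥-elim ∘ x∉A₀ , ⊥-elim ∘ y∉A₀
      ∈A₀⇔ (par a) = id , id

      ∈A₀⇒≡ : (s : Term N) → evalT x s ∈ A₀ → evalT x s ≡ evalT y s
      ∈A₀⇒≡ var     x∈A₀ = ⊥-elim (x∉A₀ x∈A₀)
      ∈A₀⇒≡ (par a) _    = refl

    numTypes≤1+∣A₀─A∣ : ∀ {t} → NumTypes R A t → t ≤ suc ∣ A₀ ─ A ∣
    numTypes≤1+∣A₀─A∣ (r , r∉A , distinct , _) =
      injective⇒≤∣p∣ (inside ∷ (A₀ ─ A)) (λ {i} {j} e → distinct i j (tag-sameTp i j _ _ e)) tag∈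
      where
      tag : (x : Fin N) → Dec (x ∈ A₀) → Fin (suc N)
      tag x (yes _) = suc x
      tag x (no _)  = zero

      tag-sameTp : ∀ i j (dᵢ : Dec (r i ∈ A₀)) (dⱼ : Dec (r j ∈ A₀)) →
                   tag (r i) dᵢ ≡ tag (r j) dⱼ → SameTp R A (r i) (r j)
      tag-sameTp i j (yes _)    (yes _)     e  = ≡⇒sameTp (suc-injective e)
      tag-sameTp i j (no r∉A₀) (no r'∉A₀) _  = sameTp-outside (r∉A i) (r∉A j) r∉A₀ r'∉A₀
      tag-sameTp i j (yes _)    (no _)      ()
      tag-sameTp i j (no _)     (yes _)     ()

      tag∈ : ∀ i → tag (r i) (r i ∈? A₀) ∈ inside ∷ (A₀ ─ A)
      tag∈ i with r i ∈? A₀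
      ... | yes r∈A₀ = there (x∈p∧x∉q⇒x∈p─q r∈A₀ (r∉A i))
      ... | no _     = here

    module _ (disjoint : Empty (A₀ ∩ A)) where

      ∈A₀⇒var : ∀ {x} (s : Term N) → TermOver A s → evalT x s ∈ A₀ → s ≡ var
      ∈A₀⇒var var     _   _    = refl
      ∈A₀⇒var (par a) a∈A a∈A₀ = ⊥-elim (disjoint (a , x∈p∩q⁺ (a∈A₀ , a∈A)))

      approx-samePattern : ∀ {x} (ts ts' : Fin n → Term N) → x ∉ A →
        TupleOver A ts → TupleOver A ts' → SamePattern ts ts' →
        Approx A₀ (instantiate x ts) (instantiate x ts')
      approx-samePattern {x} ts ts' x∉A ts⊆A ts'⊆A same =
          (λ i → (λ p → subst (_∈ A₀) (∈A₀⇒≡ ts ts' ts⊆A same i p) p)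
               , (λ p → subst (_∈ A₀) (∈A₀⇒≡ ts' ts ts'⊆A (samePattern-sym ts ts' same) i p) p))
        , ∈A₀⇒≡ ts ts' ts⊆A same
        , (λ i j → ≡-instance ts ts' ts⊆A same
                 , ≡-instance ts' ts ts'⊆A (samePattern-sym ts ts' same))
        where
        ∈A₀⇒≡ : ∀ us us' → TupleOver A us → SamePattern us us' → ∀ i →
                instantiate x us i ∈ A₀ → instantiate x us i ≡ instantiate x us' i
        ∈A₀⇒≡ us us' us⊆A same i p =
          cong (evalT x) (trans us≡var (sym (var-transfer (us' i) (same i i) us≡var)))
          where
          us≡var : us i ≡ var
          us≡var = ∈A₀⇒var (us i) (us⊆A i) p

        ≡-instance : ∀ us us' {i j} → TupleOver A us → SamePattern us us' →
                     instantiate x us i ≡ instantiate x us j →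
                     instantiate x us' i ≡ instantiate x us' j
        ≡-instance us us' {i} {j} us⊆A same =
          cong (evalT x) ∘ ≡-transfer (us' i) (us' j) (same i i) (same j j) (same i j)
                         ∘ evalT-injective x∉A (us i) (us j) (us⊆A i) (us⊆A j)

      rel-samePattern : ∀ {x} (ts ts' : Fin n → Term N) → x ∉ A →
        TupleOver A ts → TupleOver A ts' → SamePattern ts ts' →
        R (instantiate x ts) ≡ true → R (instantiate x ts') ≡ true
      rel-samePattern ts ts' x∉A ts⊆A ts'⊆A same =
        proj₁ (det _ _ (approx-samePattern ts ts' x∉A ts⊆A ts'⊆A same))

      Realised : Fin N → Fin (2 ^ (n * n)) → Set
      Realised x c = ∃ λ (w : Fin (suc N ^ n)) →
        TupleOver A (tupleOf n w) ×
        patternBits (tupleOf n w) ≗ finToFun c ×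
        R (instantiate x (tupleOf n w)) ≡ true

      realised? : ∀ x c → Dec (Realised x c)
      realised? x c = any? λ w →
        tupleOver? A (tupleOf n w) ×-dec
        all? (λ k → patternBits (tupleOf n w) k ≟ finToFun c k) ×-dec
        R (instantiate x (tupleOf n w)) Bool.≟ true

      -- By rel-samePattern, whether x realises each pattern determines the type of x over A.
      typeCode : Fin N → Fin (2 ^ (2 ^ (n * n)))
      typeCode x = funToFin λ c → bit (isYes (realised? x c))

      realised-transfer : ∀ {x y} c → typeCode x ≡ typeCode y → Realised x c → Realised y c
      realised-transfer {x} {y} c codes≡ realisedˣ =
        toWitness {a? = realised? y c}
          (subst T isYes≡ (fromWitness {a? = realised? x c} realisedˣ))
        where
        open ≡-Reasoning
        isYes≡ : isYes (realised? x c) ≡ isYes (realised? y c)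
        isYes≡ = bit-injective (begin
          bit (isYes (realised? x c)) ≡⟨ finToFun-funToFin _ c ⟨
          finToFun (typeCode x) c     ≡⟨ cong (λ code → finToFun code c) codes≡ ⟩
          finToFun (typeCode y) c     ≡⟨ finToFun-funToFin _ c ⟩
          bit (isYes (realised? y c)) ∎)

      realised-own-pattern : ∀ {x} ts → x ∉ A → TupleOver A ts → R (instantiate x ts) ≡ true →
                             Realised x (funToFin (patternBits ts))
      realised-own-pattern ts x∉A ts⊆A rel =
        w , ts₀⊆A , bits≡ ,
        rel-samePattern ts ts₀ x∉A ts⊆A ts₀⊆A (≗⇒samePattern (sym ∘ ts₀≗ts)) rel
        where
        w   = funToFin (indexOf ∘ ts)
        ts₀ = tupleOf n w

        ts₀≗ts : ts₀ ≗ ts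
        ts₀≗ts = tupleOf-funToFin ts

        ts₀⊆A : TupleOver A ts₀
        ts₀⊆A i = subst (TermOver A) (sym (ts₀≗ts i)) (ts⊆A i)

        bits≡ : patternBits ts₀ ≗ finToFun (funToFin (patternBits ts))
        bits≡ k = trans (cong bit (≗⇒samePattern ts₀≗ts _ _))
                        (sym (finToFun-funToFin (patternBits ts) k))

      typeCode-rel : ∀ {x y} → x ∉ A → y ∉ A → typeCode x ≡ typeCode y →
        ∀ ts → TupleOver A ts → R (instantiate x ts) ≡ true → R (instantiate y ts) ≡ true
      typeCode-rel x∉A y∉A codes≡ ts ts⊆A rel
        with w , ts₁⊆A , bits₁ , rel₁
               ← realised-transfer _ codes≡ (realised-own-pattern ts x∉A ts⊆A rel) =
        rel-samePattern (tupleOf n w) ts y∉A ts₁⊆A ts⊆A same rel₁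
        where
        same : SamePattern (tupleOf n w) ts
        same = patternBits⇒samePattern (tupleOf n w) ts λ k →
          trans (bits₁ k) (finToFun-funToFin (patternBits ts) k)

      numTypes≤2^2^n² : ∀ {t} → NumTypes R A t → t ≤ 2 ^ (2 ^ (n * n))
      numTypes≤2^2^n² (r , r∉A , distinct , _) =
        injective⇒≤ {f = typeCode ∘ r} λ {i} {j} codes≡ →
          distinct i j (sameTp-fromRel (r∉A i) (r∉A j) λ ts ts⊆A →
            typeCode-rel (r∉A i) (r∉A j) codes≡ ts ts⊆A ,
            typeCode-rel (r∉A j) (r∉A i) (sym codes≡) ts ts⊆A)

fact3p2 : (N n : ℕ) (R : Rel N n) (m k : ℕ) →
          IsLambda1 R m → IsLambda0' R k →
          (m ≤ suc k) × (m ≡ suc k → m ≤ 2 ^ (2 ^ (n * n)))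
fact3p2 N n R m k ((A , types) , _) ((A₀ , det , ∣A₀∣≡k) , _) = m≤1+k , m≤2^2^n²
  where
  m≤1+∣A₀─A∣ : m ≤ suc ∣ A₀ ─ A ∣
  m≤1+∣A₀─A∣ = numTypes≤1+∣A₀─A∣ R A A₀ det types

  m≤1+k : m ≤ suc k
  m≤1+k = ≤-trans m≤1+∣A₀─A∣ (s≤s (subst (∣ A₀ ─ A ∣ ≤_) ∣A₀∣≡k (∣p─q∣≤∣p∣ A₀ A)))

  m≤2^2^n² : m ≡ suc k → m ≤ 2 ^ (2 ^ (n * n))
  m≤2^2^n² m≡1+k = numTypes≤2^2^n² R A A₀ det disjoint types
    where
    disjoint : Empty (A₀ ∩ A)
    disjoint meet = <-irrefl refl (begin
      suc k          ≡⟨ m≡1+k ⟨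
      m              ≤⟨ m≤1+∣A₀─A∣ ⟩
      suc ∣ A₀ ─ A ∣ ≤⟨ p∩q≢∅⇒∣p─q∣<∣p∣ A₀ A meet ⟩
      ∣ A₀ ∣         ≡⟨ ∣A₀∣≡k ⟩
      k              ∎)
      where open ≤-Reasoning
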